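{- For every integer $n\ge 2$ and $d=\binom{n}{2}$, there is a $d$-dimensional $0/1$-polytope in $\mathbb{R}^d$ that is $3$-neighborly and has more than $2^{\sqrt{2d}-1/2}$ vertices.
   Context: A $0/1$-polytope in $\mathbb{R}^d$ is the convex hull of a subset of $\{0,1\}^d$. A polytope is $3$-neighborly if any three distinct vertices of it are the vertex set of a (triangular) face of it. -}

module Defs where

open import Data.Bool using (Bool; true; false; if_then_else_)
open import Data.Nat as ℕ using (ℕ; suc; _^_)
open import Data.Integer as ℤ using (ℤ; 0ℤ)
open import Data.Vec using (Vec; []; _∷_; lookup)
open import Data.Fin using (Fin)
open import Data.List using (List; length)
open import Data.List.Membership.Propositional using (_∈_)
open import Data.List.Relation.Unary.Unique.Propositional using (Unique)
open import Data.Product using (Σ; _×_; ∃)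
open import Data.Sum using (_⊎_)
open import Relation.Binary.PropositionalEquality using (_≡_; _≢_)
open import Function.Bundles using (_⇔_)

Point01 : ℕ → Set
Point01 d = Vec Bool d

dot : ∀ {d} → Vec ℤ d → Point01 d → ℤ
dot [] [] = 0ℤ
dot (c ∷ cs) (x ∷ xs) = (if x then c else 0ℤ) ℤ.+ dot cs xs

-- conv(V) (V a list of distinct 0/1 points) is d-dimensional in ℝ^d:
-- V lies in no affine hyperplane  c · x = b  with c ≠ 0.
FullDim : ∀ {d} → List (Point01 d) → Set
FullDim {d} V =
  (c : Vec ℤ d) (b : ℤ) → (∀ w → w ∈ V → dot c w ≡ b) → (i : Fin d) → lookup c i ≡ 0ℤ

-- {x,y,z} is the vertex set of a face of conv(V): some supporting
-- hyperplane c · w ≤ b of V meets V exactly in {x,y,z}.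
IsFaceVertexSet3 : ∀ {d} → List (Point01 d) → Point01 d → Point01 d → Point01 d → Set
IsFaceVertexSet3 {d} V x y z =
  Σ (Vec ℤ d) λ c → Σ ℤ λ b →
    (∀ w → w ∈ V → dot c w ℤ.≤ b) ×
    (∀ w → w ∈ V → (dot c w ≡ b) ⇔ (w ≡ x ⊎ w ≡ y ⊎ w ≡ z))

ThreeNeighborly : ∀ {d} → List (Point01 d) → Set
ThreeNeighborly V =
  ∀ x y z → x ∈ V → y ∈ V → z ∈ V → x ≢ y → y ≢ z → x ≢ z →
    IsFaceVertexSet3 V x y z

-- N > 2^(√(2d) − 1/2), stated without reals:
-- there is a rational p/q > √(2d) − 1/2 (i.e. (2p+q)² > 8 d q²) with 2^p ≤ N^q.
MoreThanBound : ℕ → ℕ → Set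
MoreThanBound d N =
  Σ ℕ λ p → Σ ℕ λ q → (1 ℕ.≤ q) ×
    (8 ℕ.* d ℕ.* (q ℕ.* q) ℕ.< (2 ℕ.* p ℕ.+ q) ℕ.* (2 ℕ.* p ℕ.+ q)) ×
    (2 ^ p ℕ.≤ N ^ q)

-- The vertices are the cut vectors δ(S) ∈ {0,1}^E(K_n), 0 ∉ S, of the complete graph: 2^(n−1) points
-- in dimension d = (n choose 2), and 2^(n−1) > 2^(√(2d) − 1/2) since (2n − 1)² = 8d + 1.
-- The cut polytope is full-dimensional because 2 c_ij = c·δ({i}) + c·δ({j}) − c·δ({i,j}) for every
-- linear functional c. For 3-neighborliness, switching w ↦ δ(S) ⊕ w permutes the cut vectors and
-- maps any triple to one of the form {δ(∅), δ(A), δ(B)}. A supporting functional for that triple charges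
-- −1 on every edge inside a class of the partition of the vertices by (A, B), so that cuts on the face are
-- unions of classes, and adds weights between representatives of the (at most four) classes that
-- leave exactly ∅, A and B.
module Submission where

open import Defs
open import Algebra.Bundles using (CommutativeRing)
open import Algebra.Definitions using (Commutative)
import Algebra.Properties.CommutativeSemigroup as CommutativeSemigroupProperties
open import Data.Bool using (Bool; true; false; _xor_; _∧_; _∨_; not; if_then_else_)
import Data.Bool.Properties as Boolₚ
open import Data.Empty using (⊥; ⊥-elim)
open import Data.Fin as Fin using (Fin; zero; suc; _↑ˡ_; _↑ʳ_)
import Data.Fin.Properties as Finₚ
open import Data.Integer as ℤ using (ℤ; 0ℤ; 1ℤ; -1ℤ; _+_; _-_; -_)
import Data.Integer.Properties as ℤₚ
import Data.Integer.Tactic.RingSolver as ℤSolver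
open import Algebra.Properties.CommutativeMonoid.Sum ℤₚ.+-0-commutativeMonoid
  using (sum; sum-cong-≗; ∑-distrib-+; sum-replicate-zero)
open import Data.List as List using (List; []; _∷_; map; length)
import Data.List.Properties as Listₚ
open import Data.List.Membership.Propositional using (_∈_)
open import Data.List.Membership.Propositional.Properties using (∈-map⁺; ∈-map⁻; ∈-++⁺ˡ; ∈-++⁺ʳ)
open import Data.List.Relation.Unary.All as All using (All; []; _∷_)
import Data.List.Relation.Unary.AllPairs as AllPairs
open import Data.List.Relation.Unary.Any using (here; there)
open import Data.List.Relation.Unary.Unique.Propositional using (Unique)
import Data.List.Relation.Unary.Unique.Propositional.Properties as Uniqueₚ
open import Data.Nat as ℕ using (ℕ; zero; suc; _≤_; _^_; s≤s; z≤n)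
import Data.Nat.Properties as ℕₚ
import Data.Nat.Tactic.RingSolver as ℕSolver
open import Data.Nat.Combinatorics using (_C_; nC1≡n; nCk+nC[k+1]≡[n+1]C[k+1])
open import Data.Product using (Σ; ∃; _×_; _,_; proj₁; proj₂)
open import Data.Sum as Sum using (_⊎_; inj₁; inj₂)
open import Data.Sum.Function.Propositional using (_⊎-cong_)
open import Data.Vec as Vec using (Vec; []; _∷_; lookup; tabulate; _++_)
import Data.Vec.Properties as Vecₚ
open import Function using (_∘_; _⇔_; mk⇔)
import Function.Properties.Equivalence as ⇔
open import Relation.Binary.PropositionalEquality
open import Relation.Nullary using (¬_; Dec; does; yes; no)
open import Relation.Nullary.Decidable using (_×-dec_)

open CommutativeSemigroupProperties ℤₚ.+-commutativeSemigroup using (interchange)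
open CommutativeSemigroupProperties (CommutativeRing.+-commutativeSemigroup Boolₚ.xor-∧-commutativeRing)
  using () renaming (interchange to xor-interchange)

-- Edges of the complete graph

-- The edges of K_(k+1) are inj₁ j = {0, j + 1} and the edges inj₂ e of K_k shifted up by one.
Edge : ℕ → Set
Edge zero    = ⊥
Edge (suc k) = Fin k ⊎ Edge k

lo hi : ∀ {n} → Edge n → Fin n
lo {suc k} (inj₁ j) = zero
lo {suc k} (inj₂ e) = suc (lo e)
hi {suc k} (inj₁ j) = suc j
hi {suc k} (inj₂ e) = suc (hi e)

lo≢hi : ∀ {n} (e : Edge n) → lo e ≢ hi e
lo≢hi {suc k} (inj₁ j) ()
lo≢hi {suc k} (inj₂ e) eq = lo≢hi e (Finₚ.suc-injective eq)

Joins : ∀ {n} → Edge n → Fin n → Fin n → Set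
Joins e a b = (lo e ≡ a × hi e ≡ b) ⊎ (lo e ≡ b × hi e ≡ a)

edgeJoining : ∀ {n} {a b : Fin n} → a ≢ b → ∃ λ e → Joins e a b
edgeJoining {a = zero}  {zero}  a≢b = ⊥-elim (a≢b refl)
edgeJoining {a = zero}  {suc b} a≢b = inj₁ b , inj₁ (refl , refl)
edgeJoining {a = suc a} {zero}  a≢b = inj₁ a , inj₂ (refl , refl)
edgeJoining {a = suc a} {suc b} a≢b with edgeJoining (a≢b ∘ cong suc)
... | e , inj₁ (refl , refl) = inj₂ e , inj₁ (refl , refl)
... | e , inj₂ (refl , refl) = inj₂ e , inj₂ (refl , refl)

joins-comm : ∀ {n} {e : Edge n} {a b} → Joins e a b →
             (_⊙_ : Bool → Bool → Bool) → Commutative _≡_ _⊙_ →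
             (g : Fin n → Bool) → g (lo e) ⊙ g (hi e) ≡ g a ⊙ g b
joins-comm (inj₁ (refl , refl)) _⊙_ comm g = refl
joins-comm (inj₂ (refl , refl)) _⊙_ comm g = comm (g _) (g _)

edgeCount : ℕ → ℕ
edgeCount zero    = 0
edgeCount (suc k) = k ℕ.+ edgeCount k

edgeCount≡C2 : ∀ n → edgeCount n ≡ n C 2
edgeCount≡C2 zero    = refl
edgeCount≡C2 (suc k) = trans (cong₂ ℕ._+_ (sym (nC1≡n k)) (edgeCount≡C2 k)) (nCk+nC[k+1]≡[n+1]C[k+1] k 1)

edgeIndex : ∀ {n} → Edge n → Fin (edgeCount n)
edgeIndex {suc k} (inj₁ j) = j ↑ˡ edgeCount k
edgeIndex {suc k} (inj₂ e) = k ↑ʳ edgeIndex e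

edgeIndex-surjective : ∀ n (i : Fin (edgeCount n)) → ∃ λ (e : Edge n) → edgeIndex e ≡ i
edgeIndex-surjective (suc k) i with Fin.splitAt k i in split
... | inj₁ j = inj₁ j , Finₚ.splitAt⁻¹-↑ˡ split
... | inj₂ r with edgeIndex-surjective k r
...   | e , refl = inj₂ e , Finₚ.splitAt⁻¹-↑ʳ split

tabulateEdges : ∀ {A : Set} {n} → (Edge n → A) → Vec A (edgeCount n)
tabulateEdges {n = zero}  f = []
tabulateEdges {n = suc k} f = tabulate (f ∘ inj₁) ++ tabulateEdges (f ∘ inj₂)

lookup-tabulateEdges : ∀ {A : Set} {n} (f : Edge n → A) e → lookup (tabulateEdges f) (edgeIndex e) ≡ f e
lookup-tabulateEdges {n = suc k} f (inj₁ j) =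
  trans (Vecₚ.lookup-++ˡ (tabulate (f ∘ inj₁)) _ j) (Vecₚ.lookup∘tabulate (f ∘ inj₁) j)
lookup-tabulateEdges {n = suc k} f (inj₂ e) =
  trans (Vecₚ.lookup-++ʳ (tabulate (f ∘ inj₁)) _ (edgeIndex e)) (lookup-tabulateEdges (f ∘ inj₂) e)

lookup-extensionality : ∀ {A : Set} {k} {xs ys : Vec A k} → (∀ i → lookup xs i ≡ lookup ys i) → xs ≡ ys
lookup-extensionality {xs = xs} {ys} eq = begin
  xs                   ≡⟨ Vecₚ.tabulate∘lookup xs ⟨
  tabulate (lookup xs) ≡⟨ Vecₚ.tabulate-cong eq ⟩
  tabulate (lookup ys) ≡⟨ Vecₚ.tabulate∘lookup ys ⟩
  ys                   ∎
  where open ≡-Reasoning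

≡-byEdges : ∀ {A : Set} n {xs ys : Vec A (edgeCount n)} →
            (∀ (e : Edge n) → lookup xs (edgeIndex e) ≡ lookup ys (edgeIndex e)) → xs ≡ ys
≡-byEdges n {xs} {ys} eq = lookup-extensionality atIndex
  where
  atIndex : ∀ i → lookup xs i ≡ lookup ys i
  atIndex i with edgeIndex-surjective n i
  ... | e , refl = eq e

select : Bool → ℤ → ℤ
select b k = if b then k else 0ℤ

select-zero : ∀ x → select x 0ℤ ≡ 0ℤ
select-zero false = refl
select-zero true  = refl

select-comm : ∀ x y (k : ℤ) → select x (select y k) ≡ select y (select x k)
select-comm false false k = refl
select-comm false true  k = refl
select-comm true  false k = refl
select-comm true  true  k = refl

select-distrib-+ : ∀ x (k l : ℤ) → select x (k + l) ≡ select x k + select x l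
select-distrib-+ false k l = refl
select-distrib-+ true  k l = refl

select-xor-∧ : ∀ x y (w : ℤ) → select x w + select y w ≡ select (x xor y) w + select (x ∧ y) (w + w)
select-xor-∧ false false w = refl
select-xor-∧ false true  w = ℤₚ.+-comm 0ℤ w
select-xor-∧ true  false w = refl
select-xor-∧ true  true  w = sym (ℤₚ.+-identityˡ (w + w))

nonpos+nonpos≡0⇒≡0 : ∀ {a b : ℤ} → a ℤ.≤ 0ℤ → b ℤ.≤ 0ℤ → a + b ≡ 0ℤ → a ≡ 0ℤ × b ≡ 0ℤ
nonpos+nonpos≡0⇒≡0 {a} {b} a≤0 b≤0 a+b≡0 =
  a≡0 , trans (sym (ℤₚ.+-identityˡ b)) (trans (cong (_+ b) (sym a≡0)) a+b≡0)
  where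
  a≡0 : a ≡ 0ℤ
  a≡0 = ℤₚ.≤-antisym a≤0 (ℤₚ.≤-trans (ℤₚ.≤-reflexive (sym a+b≡0))
          (subst (a + b ℤ.≤_) (ℤₚ.+-identityʳ a) (ℤₚ.+-monoʳ-≤ a b≤0)))

sum-zero : ∀ {k} (g : Fin k → ℤ) → (∀ j → g j ≡ 0ℤ) → sum g ≡ 0ℤ
sum-zero {k} g eq = trans (sum-cong-≗ eq) (sum-replicate-zero k)

sum-nonpos : ∀ {k} (g : Fin k → ℤ) → (∀ j → g j ℤ.≤ 0ℤ) → sum g ℤ.≤ 0ℤ
sum-nonpos {zero}  g g≤0 = ℤₚ.≤-refl
sum-nonpos {suc k} g g≤0 = ℤₚ.+-mono-≤ (g≤0 zero) (sum-nonpos (g ∘ suc) (g≤0 ∘ suc))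

sum-nonpos-zero : ∀ {k} (g : Fin k → ℤ) → (∀ j → g j ℤ.≤ 0ℤ) → sum g ≡ 0ℤ → ∀ j → g j ≡ 0ℤ
sum-nonpos-zero {suc k} g g≤0 sum≡0 j
  with nonpos+nonpos≡0⇒≡0 (g≤0 zero) (sum-nonpos (g ∘ suc) (g≤0 ∘ suc)) sum≡0
sum-nonpos-zero {suc k} g g≤0 sum≡0 zero    | g0≡0 , _    = g0≡0
sum-nonpos-zero {suc k} g g≤0 sum≡0 (suc j) | _ , rest≡0 = sum-nonpos-zero (g ∘ suc) (g≤0 ∘ suc) rest≡0 j

singleton : ∀ {n} → Fin n → Fin n → Bool
singleton i v = does (v Fin.≟ i)

sum-singleton : ∀ {k} (g : Fin k → ℤ) (j : Fin k) → sum (λ l → select (singleton j l) (g l)) ≡ g j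
sum-singleton {suc k} g zero    = trans (cong (g zero +_) (sum-zero {k} _ λ _ → refl)) (ℤₚ.+-identityʳ (g zero))
sum-singleton {suc k} g (suc j) = trans (ℤₚ.+-identityˡ _) (sum-singleton (g ∘ suc) j)

sumEdges : ∀ {n} → (Edge n → ℤ) → ℤ
sumEdges {zero}  g = 0ℤ
sumEdges {suc k} g = sum (g ∘ inj₁) + sumEdges (g ∘ inj₂)

sumEdges-cong : ∀ {n} {g h : Edge n → ℤ} → (∀ e → g e ≡ h e) → sumEdges g ≡ sumEdges h
sumEdges-cong {zero}  eq = refl
sumEdges-cong {suc k} eq = cong₂ _+_ (sum-cong-≗ (eq ∘ inj₁)) (sumEdges-cong (eq ∘ inj₂))

sumEdges-zero : ∀ {n} (g : Edge n → ℤ) → (∀ e → g e ≡ 0ℤ) → sumEdges g ≡ 0ℤ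
sumEdges-zero {zero}  g eq = refl
sumEdges-zero {suc k} g eq = cong₂ _+_ (sum-zero (g ∘ inj₁) (eq ∘ inj₁)) (sumEdges-zero (g ∘ inj₂) (eq ∘ inj₂))

sumEdges-distrib-+ : ∀ {n} (g h : Edge n → ℤ) → sumEdges (λ e → g e + h e) ≡ sumEdges g + sumEdges h
sumEdges-distrib-+ {zero}  g h = refl
sumEdges-distrib-+ {suc k} g h = trans
  (cong₂ _+_ (∑-distrib-+ (g ∘ inj₁) (h ∘ inj₁)) (sumEdges-distrib-+ (g ∘ inj₂) (h ∘ inj₂)))
  (interchange (sum (g ∘ inj₁)) (sum (h ∘ inj₁)) (sumEdges (g ∘ inj₂)) (sumEdges (h ∘ inj₂)))

sumEdges-nonpos : ∀ {n} (g : Edge n → ℤ) → (∀ e → g e ℤ.≤ 0ℤ) → sumEdges g ℤ.≤ 0ℤ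
sumEdges-nonpos {zero}  g g≤0 = ℤₚ.≤-refl
sumEdges-nonpos {suc k} g g≤0 =
  ℤₚ.+-mono-≤ (sum-nonpos (g ∘ inj₁) (g≤0 ∘ inj₁)) (sumEdges-nonpos (g ∘ inj₂) (g≤0 ∘ inj₂))

sumEdges-nonpos-zero : ∀ {n} (g : Edge n → ℤ) → (∀ e → g e ℤ.≤ 0ℤ) → sumEdges g ≡ 0ℤ →
                       ∀ e → g e ≡ 0ℤ
sumEdges-nonpos-zero {suc k} g g≤0 sum≡0 e
  with nonpos+nonpos≡0⇒≡0 (sum-nonpos (g ∘ inj₁) (g≤0 ∘ inj₁))
                           (sumEdges-nonpos (g ∘ inj₂) (g≤0 ∘ inj₂)) sum≡0
sumEdges-nonpos-zero {suc k} g g≤0 sum≡0 (inj₁ j) | first≡0 , _ =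
  sum-nonpos-zero (g ∘ inj₁) (g≤0 ∘ inj₁) first≡0 j
sumEdges-nonpos-zero {suc k} g g≤0 sum≡0 (inj₂ e) | _ , rest≡0 =
  sumEdges-nonpos-zero (g ∘ inj₂) (g≤0 ∘ inj₂) rest≡0 e

cut : ∀ {n} → (Fin n → Bool) → Edge n → Bool
cut s e = s (lo e) xor s (hi e)

cut-xor : ∀ {n} (s t : Fin n → Bool) e → cut (λ v → s v xor t v) e ≡ cut s e xor cut t e
cut-xor s t e = xor-interchange (s (lo e)) (t (lo e)) (s (hi e)) (t (hi e))

links : ∀ {n} → Fin n → Fin n → Edge n → Bool
links a b e = cut (singleton a) e ∧ cut (singleton b) e

sumEdges-links : ∀ {n} (q : Edge n) (h : Edge n → ℤ) →
                 sumEdges (λ e → select (links (lo q) (hi q) e) (h e)) ≡ h q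
sumEdges-links {suc k} (inj₁ j) h = trans
  (cong₂ _+_ (sum-singleton (h ∘ inj₁) j) (sumEdges-zero {k} _ λ _ → refl))
  (ℤₚ.+-identityʳ (h (inj₁ j)))
sumEdges-links {suc k} (inj₂ q) h = trans
  (cong₂ _+_ (sum-zero _ λ l → cong (λ b → select b (h (inj₁ l))) (ends-differ l))
             (sumEdges-links q (h ∘ inj₂)))
  (ℤₚ.+-identityˡ (h (inj₂ q)))
  where
  ends-differ : ∀ l → singleton (lo q) l ∧ singleton (hi q) l ≡ false
  ends-differ l with l Fin.≟ lo q | l Fin.≟ hi q
  ... | yes refl | yes l≡hi = ⊥-elim (lo≢hi q l≡hi)
  ... | yes _    | no _     = refl
  ... | no _     | _        = refl

sumEdges-links-cut : ∀ {n} {a b : Fin n} → a ≢ b → ∀ (u : Fin n → Bool) k →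
  sumEdges (λ e → select (cut u e) (select (links a b e) k)) ≡ select (u a xor u b) k
sumEdges-links-cut {a = a} {b} a≢b u k with edgeJoining a≢b
... | q , joins = begin
  sumEdges (λ e → select (cut u e) (select (links a b e) k))
    ≡⟨ sumEdges-cong (λ e → trans (select-comm (cut u e) (links a b e) k)
                                   (cong (λ x → select x (select (cut u e) k)) (links-q e))) ⟩
  sumEdges (λ e → select (links (lo q) (hi q) e) (select (cut u e) k))
    ≡⟨ sumEdges-links q (λ e → select (cut u e) k) ⟩
  select (cut u q) k
    ≡⟨ cong (λ x → select x k) (joins-comm joins _xor_ Boolₚ.xor-comm u) ⟩
  select (u a xor u b) k ∎
  where
  open ≡-Reasoning
  links-q : ∀ e → links a b e ≡ links (lo q) (hi q) e
  links-q e = sym (joins-comm joins _∧_ Boolₚ.∧-comm (λ v → cut (singleton v) e))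

WeightedPairs : ℕ → Set
WeightedPairs n = List (Fin n × Fin n × ℤ)

Distinct : ∀ {n} → Fin n × Fin n × ℤ → Set
Distinct (a , b , _) = a ≢ b

pairWeights : ∀ {n} → WeightedPairs n → Edge n → ℤ
pairWeights []                 e = 0ℤ
pairWeights ((a , b , k) ∷ ps) e = select (links a b e) k + pairWeights ps e

cutWeight : ∀ {n} → (Fin n → Bool) → WeightedPairs n → ℤ
cutWeight u []                 = 0ℤ
cutWeight u ((a , b , k) ∷ ps) = select (u a xor u b) k + cutWeight u ps

sumEdges-pairWeights : ∀ {n} (u : Fin n → Bool) (ps : WeightedPairs n) → All Distinct ps →
  sumEdges (λ e → select (cut u e) (pairWeights ps e)) ≡ cutWeight u ps
sumEdges-pairWeights u [] [] = sumEdges-zero _ (λ e → select-zero (cut u e))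
sumEdges-pairWeights u ((a , b , k) ∷ ps) (a≢b ∷ distinct) = begin
  sumEdges (λ e → select (cut u e) (select (links a b e) k + pairWeights ps e))
    ≡⟨ sumEdges-cong (λ e → select-distrib-+ (cut u e) (select (links a b e) k) (pairWeights ps e)) ⟩
  sumEdges (λ e → select (cut u e) (select (links a b e) k) + select (cut u e) (pairWeights ps e))
    ≡⟨ sumEdges-distrib-+ (λ e → select (cut u e) (select (links a b e) k))
                          (λ e → select (cut u e) (pairWeights ps e)) ⟩
  sumEdges (λ e → select (cut u e) (select (links a b e) k)) + sumEdges (λ e → select (cut u e) (pairWeights ps e))
    ≡⟨ cong₂ _+_ (sumEdges-links-cut a≢b u k) (sumEdges-pairWeights u ps distinct) ⟩
  select (u a xor u b) k + cutWeight u ps ∎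
  where open ≡-Reasoning

xor-cancelˡ : ∀ x y → x xor (x xor y) ≡ y
xor-cancelˡ x y = trans (sym (Boolₚ.xor-assoc x x y)) (cong (_xor y) (Boolₚ.xor-same x))

xor≡false⇒≡ : ∀ x y → x xor y ≡ false → x ≡ y
xor≡false⇒≡ x y x⊕y≡false =
  trans (sym (Boolₚ.xor-identityʳ x)) (trans (cong (x xor_) (sym x⊕y≡false)) (xor-cancelˡ x y))

_⊕_ : ∀ {d} → Point01 d → Point01 d → Point01 d
_⊕_ = Vec.zipWith _xor_

⊕-cancelˡ : ∀ {d} (t w : Point01 d) → t ⊕ (t ⊕ w) ≡ w
⊕-cancelˡ []       []       = refl
⊕-cancelˡ (t ∷ ts) (w ∷ ws) = cong₂ _∷_ (xor-cancelˡ t w) (⊕-cancelˡ ts ws)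

⊕-injective : ∀ {d} (t : Point01 d) {w y} → t ⊕ w ≡ t ⊕ y → w ≡ y
⊕-injective t {w} {y} eq = trans (sym (⊕-cancelˡ t w)) (trans (cong (t ⊕_) eq) (⊕-cancelˡ t y))

flipSigns : ∀ {d} → Point01 d → Vec ℤ d → Vec ℤ d
flipSigns = Vec.zipWith (λ t c → if t then - c else c)

dot-⊕ : ∀ {d} (t w : Point01 d) (c : Vec ℤ d) → dot c (t ⊕ w) ≡ dot (flipSigns t c) w + dot c t
dot-⊕ []       []       []       = refl
dot-⊕ (t ∷ ts) (w ∷ ws) (c ∷ cs) = trans
  (cong₂ _+_ (coordinate t w) (dot-⊕ ts ws cs))
  (interchange (select w (if t then - c else c)) (select t c) (dot (flipSigns ts cs) ws) (dot cs ts))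
  where
  coordinate : ∀ t w → select (t xor w) c ≡ select w (if t then - c else c) + select t c
  coordinate false false = refl
  coordinate false true  = sym (ℤₚ.+-identityʳ c)
  coordinate true  false = sym (ℤₚ.+-identityˡ c)
  coordinate true  true  = sym (ℤₚ.+-inverseˡ c)

dot-++ : ∀ {a b} (xs : Vec ℤ a) (ys : Vec ℤ b) (us : Point01 a) (vs : Point01 b) →
         dot (xs ++ ys) (us ++ vs) ≡ dot xs us + dot ys vs
dot-++ []       ys []       vs = sym (ℤₚ.+-identityˡ _)
dot-++ (x ∷ xs) ys (u ∷ us) vs =
  trans (cong (select u x +_) (dot-++ xs ys us vs)) (sym (ℤₚ.+-assoc (select u x) (dot xs us) (dot ys vs)))

dot-tabulate : ∀ {k} (c : Vec ℤ k) (f : Fin k → Bool) → dot c (tabulate f) ≡ sum (λ j → select (f j) (lookup c j))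
dot-tabulate []       f = refl
dot-tabulate (c ∷ cs) f = cong (select (f zero) c +_) (dot-tabulate cs (f ∘ suc))

dot-tabulateEdges : ∀ n (c : Vec ℤ (edgeCount n)) (f : Edge n → Bool) →
  dot c (tabulateEdges f) ≡ sumEdges (λ e → select (f e) (lookup c (edgeIndex e)))
dot-tabulateEdges zero    [] f = refl
dot-tabulateEdges (suc k) c  f with Vec.splitAt k c
... | xs , ys , refl = begin
  dot (xs ++ ys) (tabulate (f ∘ inj₁) ++ tabulateEdges (f ∘ inj₂))
    ≡⟨ dot-++ xs ys _ _ ⟩
  dot xs (tabulate (f ∘ inj₁)) + dot ys (tabulateEdges (f ∘ inj₂))
    ≡⟨ cong₂ _+_ (dot-tabulate xs (f ∘ inj₁)) (dot-tabulateEdges k ys (f ∘ inj₂)) ⟩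
  sum (λ j → select (f (inj₁ j)) (lookup xs j)) + sumEdges (λ e → select (f (inj₂ e)) (lookup ys (edgeIndex e)))
    ≡⟨ cong₂ _+_ (sum-cong-≗ λ j → cong (select (f (inj₁ j))) (sym (Vecₚ.lookup-++ˡ xs ys j)))
                 (sumEdges-cong λ e → cong (select (f (inj₂ e))) (sym (Vecₚ.lookup-++ʳ xs ys (edgeIndex e)))) ⟩
  sumEdges (λ e → select (f e) (lookup (xs ++ ys) (edgeIndex e))) ∎
  where open ≡-Reasoning

-- Cut vectors

∅ : ∀ {n} → Fin n → Bool
∅ _ = false

cutVector : ∀ {n} → (Fin n → Bool) → Point01 (edgeCount n)
cutVector s = tabulateEdges (cut s)

cutVector-≡ : ∀ {n} (s t : Fin n → Bool) → (∀ e → cut s e ≡ cut t e) → cutVector s ≡ cutVector t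
cutVector-≡ {n} s t eq = ≡-byEdges n λ e →
  trans (lookup-tabulateEdges (cut s) e) (trans (eq e) (sym (lookup-tabulateEdges (cut t) e)))

cutVector-cong : ∀ {n} {s t : Fin n → Bool} → (∀ v → s v ≡ t v) → cutVector s ≡ cutVector t
cutVector-cong {n} {s} {t} eq = cutVector-≡ s t λ e → cong₂ _xor_ (eq (lo e)) (eq (hi e))

cutVector-⊕ : ∀ {n} (s t : Fin n → Bool) → cutVector s ⊕ cutVector t ≡ cutVector (λ v → s v xor t v)
cutVector-⊕ {n} s t = ≡-byEdges n λ e → begin
  lookup (cutVector s ⊕ cutVector t) (edgeIndex e)
    ≡⟨ Vecₚ.lookup-zipWith _xor_ (edgeIndex e) (cutVector s) (cutVector t) ⟩
  lookup (cutVector s) (edgeIndex e) xor lookup (cutVector t) (edgeIndex e)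
    ≡⟨ cong₂ _xor_ (lookup-tabulateEdges (cut s) e) (lookup-tabulateEdges (cut t) e) ⟩
  cut s e xor cut t e
    ≡⟨ cut-xor s t e ⟨
  cut (λ v → s v xor t v) e
    ≡⟨ lookup-tabulateEdges (cut (λ v → s v xor t v)) e ⟨
  lookup (cutVector (λ v → s v xor t v)) (edgeIndex e) ∎
  where open ≡-Reasoning

allVecs : ∀ m → List (Vec Bool m)
allVecs zero    = [] ∷ []
allVecs (suc m) = map (true ∷_) (allVecs m) List.++ map (false ∷_) (allVecs m)

∈-allVecs : ∀ {m} (S : Vec Bool m) → S ∈ allVecs m
∈-allVecs []          = here refl
∈-allVecs (true ∷ S)  = ∈-++⁺ˡ (∈-map⁺ (true ∷_) (∈-allVecs S))
∈-allVecs (false ∷ S) = ∈-++⁺ʳ (map (true ∷_) (allVecs _)) (∈-map⁺ (false ∷_) (∈-allVecs S))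

allVecs-unique : ∀ m → Unique (allVecs m)
allVecs-unique zero    = [] AllPairs.∷ AllPairs.[]
allVecs-unique (suc m) = Uniqueₚ.++⁺
  (Uniqueₚ.map⁺ Vecₚ.∷-injectiveʳ (allVecs-unique m))
  (Uniqueₚ.map⁺ Vecₚ.∷-injectiveʳ (allVecs-unique m))
  heads-differ
  where
  heads-differ : ∀ {S} → ¬ (S ∈ map (true ∷_) (allVecs m) × S ∈ map (false ∷_) (allVecs m))
  heads-differ (S∈ , S∈′) with ∈-map⁻ (true ∷_) S∈ | ∈-map⁻ (false ∷_) S∈′
  ... | _ , _ , refl | _ , _ , ()

length-allVecs : ∀ m → length (allVecs m) ≡ 2 ^ m
length-allVecs zero    = refl
length-allVecs (suc m) = begin
  length (map (true ∷_) (allVecs m) List.++ map (false ∷_) (allVecs m))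
    ≡⟨ Listₚ.length-++ (map (true ∷_) (allVecs m)) ⟩
  length (map (true ∷_) (allVecs m)) ℕ.+ length (map (false ∷_) (allVecs m))
    ≡⟨ cong₂ ℕ._+_ (Listₚ.length-map _ (allVecs m)) (Listₚ.length-map _ (allVecs m)) ⟩
  length (allVecs m) ℕ.+ length (allVecs m)
    ≡⟨ cong (λ l → l ℕ.+ l) (length-allVecs m) ⟩
  2 ^ m ℕ.+ 2 ^ m
    ≡⟨ cong (2 ^ m ℕ.+_) (ℕₚ.+-identityʳ (2 ^ m)) ⟨
  2 ^ suc m ∎
  where open ≡-Reasoning

-- The side of a cut of K_{m+1} that does not contain vertex 0.
shore : ∀ {m} → Vec Bool m → Fin (suc m) → Bool
shore S zero    = false
shore S (suc i) = lookup S i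

cutVertices : ∀ m → List (Point01 (edgeCount (suc m)))
cutVertices m = map (cutVector ∘ shore) (allVecs m)

∈-cutVertices : ∀ {m} (s : Fin (suc m) → Bool) → cutVector s ∈ cutVertices m
∈-cutVertices {m} s = subst (_∈ cutVertices m) (sym normalise) (∈-map⁺ (cutVector ∘ shore) (∈-allVecs S))
  where
  S : Vec Bool m
  S = tabulate (λ i → s zero xor s (suc i))
  shore-S : ∀ v → shore S v ≡ s zero xor s v
  shore-S zero    = sym (Boolₚ.xor-same (s zero))
  shore-S (suc i) = Vecₚ.lookup∘tabulate _ i
  normalise : cutVector s ≡ cutVector (shore S)
  normalise = cutVector-≡ s (shore S) λ e → sym (begin
    cut (shore S) e                        ≡⟨ cong₂ _xor_ (shore-S (lo e)) (shore-S (hi e)) ⟩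
    cut (λ v → s zero xor s v) e           ≡⟨ cut-xor (λ _ → s zero) s e ⟩
    (s zero xor s zero) xor cut s e        ≡⟨ cong (_xor cut s e) (Boolₚ.xor-same (s zero)) ⟩
    cut s e                                ∎)
    where open ≡-Reasoning

∈-cutVertices⁻ : ∀ {m w} → w ∈ cutVertices m → ∃ λ S → w ≡ cutVector (shore S)
∈-cutVertices⁻ w∈ with ∈-map⁻ (cutVector ∘ shore) w∈
... | S , _ , w≡ = S , w≡

cutVector-shore-injective : ∀ {m} {S T : Vec Bool m} → cutVector (shore S) ≡ cutVector (shore T) → S ≡ T
cutVector-shore-injective {m} {S} {T} eq = lookup-extensionality entry
  where
  open ≡-Reasoning
  entry : ∀ j → lookup S j ≡ lookup T j
  entry j = begin
    lookup S j                         ≡⟨ lookup-tabulateEdges (cut (shore S)) (inj₁ j) ⟨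
    lookup (cutVector (shore S)) index ≡⟨ cong (λ x → lookup x index) eq ⟩
    lookup (cutVector (shore T)) index ≡⟨ lookup-tabulateEdges (cut (shore T)) (inj₁ j) ⟩
    lookup T j                         ∎
    where
    index : Fin (edgeCount (suc m))
    index = edgeIndex {suc m} (inj₁ j)

cutVertices-unique : ∀ m → Unique (cutVertices m)
cutVertices-unique m = Uniqueₚ.map⁺ cutVector-shore-injective (allVecs-unique m)

length-cutVertices : ∀ m → length (cutVertices m) ≡ 2 ^ m
length-cutVertices m = trans (Listₚ.length-map _ (allVecs m)) (length-allVecs m)

⊕-cutVertices : ∀ {m} (s : Fin (suc m) → Bool) w → w ∈ cutVertices m → cutVector s ⊕ w ∈ cutVertices m
⊕-cutVertices s w w∈ with ∈-cutVertices⁻ w∈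
... | S , refl = subst (_∈ _) (sym (cutVector-⊕ s (shore S))) (∈-cutVertices (λ v → s v xor shore S v))

twice-edgeCount : ∀ m → 2 ℕ.* edgeCount (suc m) ≡ m ℕ.* suc m
twice-edgeCount zero    = refl
twice-edgeCount (suc m) = begin
  2 ℕ.* (suc m ℕ.+ edgeCount (suc m))     ≡⟨ ℕₚ.*-distribˡ-+ 2 (suc m) (edgeCount (suc m)) ⟩
  2 ℕ.* suc m ℕ.+ 2 ℕ.* edgeCount (suc m) ≡⟨ cong (2 ℕ.* suc m ℕ.+_) (twice-edgeCount m) ⟩
  2 ℕ.* suc m ℕ.+ m ℕ.* suc m             ≡⟨ factor m ⟩
  suc m ℕ.* suc (suc m)                   ∎
  where
  open ≡-Reasoning
  factor : ∀ m → 2 ℕ.* suc m ℕ.+ m ℕ.* suc m ≡ suc m ℕ.* suc (suc m)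
  factor = ℕSolver.solve-∀

-- Take p = m and q = 1: (2m + 1)² = 4m(m + 1) + 1 = 8 (m+1 choose 2) + 1.
moreThanBound-2^m : ∀ m → MoreThanBound (edgeCount (suc m)) (2 ^ m)
moreThanBound-2^m m = m , 1 , s≤s z≤n , bound , ℕₚ.≤-reflexive (sym (ℕₚ.*-identityʳ (2 ^ m)))
  where
  bound : 8 ℕ.* edgeCount (suc m) ℕ.* (1 ℕ.* 1) ℕ.< (2 ℕ.* m ℕ.+ 1) ℕ.* (2 ℕ.* m ℕ.+ 1)
  bound = subst₂ ℕ._<_ (sym (trans (lhs (edgeCount (suc m))) (cong (4 ℕ.*_) (twice-edgeCount m))))
                       (sym (rhs m)) (ℕₚ.n<1+n _)
    where
    lhs : ∀ d → 8 ℕ.* d ℕ.* (1 ℕ.* 1) ≡ 4 ℕ.* (2 ℕ.* d)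
    lhs = ℕSolver.solve-∀
    rhs : ∀ m → (2 ℕ.* m ℕ.+ 1) ℕ.* (2 ℕ.* m ℕ.+ 1) ≡ suc (4 ℕ.* (m ℕ.* suc m))
    rhs = ℕSolver.solve-∀

-- Full dimension

x+x≡0⇒x≡0 : ∀ (x : ℤ) → x + x ≡ 0ℤ → x ≡ 0ℤ
x+x≡0⇒x≡0 (ℤ.+ zero)  _  = refl
x+x≡0⇒x≡0 (ℤ.+ suc n) ()
x+x≡0⇒x≡0 ℤ.-[1+ n ]  ()

cutVertices-fullDim : ∀ m → FullDim (cutVertices m)
cutVertices-fullDim m c b onHyperplane i with edgeIndex-surjective (suc m) i
... | q , refl = x+x≡0⇒x≡0 (W q) (begin
  W q + W q                ≡⟨ ℤₚ.+-identityˡ (W q + W q) ⟨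
  0ℤ + (W q + W q)         ≡⟨ cong (_+ (W q + W q)) (value≡0 s₁⊕s₂) ⟨
  value s₁⊕s₂ + (W q + W q) ≡⟨ polarisation ⟨
  value s₁ + value s₂      ≡⟨ cong₂ _+_ (value≡0 s₁) (value≡0 s₂) ⟩
  0ℤ                       ∎)
  where
  open ≡-Reasoning
  W : Edge (suc m) → ℤ
  W e = lookup c (edgeIndex e)
  value : (Fin (suc m) → Bool) → ℤ
  value s = sumEdges (λ e → select (cut s e) (W e))
  value≡b : ∀ s → value s ≡ b
  value≡b s = trans (sym (dot-tabulateEdges (suc m) c (cut s))) (onHyperplane (cutVector s) (∈-cutVertices s))
  value≡0 : ∀ s → value s ≡ 0ℤ
  value≡0 s = trans (value≡b s)
    (trans (sym (value≡b ∅)) (sumEdges-zero (λ e → select (cut ∅ e) (W e)) λ _ → refl))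
  s₁ s₂ s₁⊕s₂ : Fin (suc m) → Bool
  s₁ = singleton (lo q)
  s₂ = singleton (hi q)
  s₁⊕s₂ v = s₁ v xor s₂ v
  polarisation : value s₁ + value s₂ ≡ value s₁⊕s₂ + (W q + W q)
  polarisation = begin
    value s₁ + value s₂
      ≡⟨ sumEdges-distrib-+ (λ e → select (cut s₁ e) (W e)) (λ e → select (cut s₂ e) (W e)) ⟨
    sumEdges (λ e → select (cut s₁ e) (W e) + select (cut s₂ e) (W e))
      ≡⟨ sumEdges-cong (λ e → trans (select-xor-∧ (cut s₁ e) (cut s₂ e) (W e))
           (cong (λ x → select x (W e) + select (links (lo q) (hi q) e) (W e + W e)) (sym (cut-xor s₁ s₂ e)))) ⟩
    sumEdges (λ e → select (cut s₁⊕s₂ e) (W e) + select (links (lo q) (hi q) e) (W e + W e))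
      ≡⟨ sumEdges-distrib-+ (λ e → select (cut s₁⊕s₂ e) (W e))
                            (λ e → select (links (lo q) (hi q) e) (W e + W e)) ⟩
    value s₁⊕s₂ + sumEdges (λ e → select (links (lo q) (hi q) e) (W e + W e))
      ≡⟨ cong (value s₁⊕s₂ +_) (sumEdges-links q (λ e → W e + W e)) ⟩
    value s₁⊕s₂ + (W q + W q) ∎

-- Supporting hyperplanes and switching

Exposes : ∀ {d} → List (Point01 d) → (Point01 d → Set) → Set
Exposes {d} V P = Σ (Vec ℤ d) λ c → Σ ℤ λ b →
  (∀ w → w ∈ V → dot c w ℤ.≤ b) × (∀ w → w ∈ V → (dot c w ≡ b) ⇔ P w)

Triple : ∀ {d} → Point01 d → Point01 d → Point01 d → Point01 d → Set
Triple x y z w = w ≡ x ⊎ w ≡ y ⊎ w ≡ z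

Exposes-⇔ : ∀ {d} {V : List (Point01 d)} {P Q : Point01 d → Set} →
            (∀ w → P w ⇔ Q w) → Exposes V P → Exposes V Q
Exposes-⇔ P⇔Q (c , b , below , onFace) = c , b , below , λ w w∈ → ⇔.trans (onFace w w∈) (P⇔Q w)

m+k-k≡m : ∀ (m k : ℤ) → m + k - k ≡ m
m+k-k≡m = ℤSolver.solve-∀

m-k+k≡m : ∀ (m k : ℤ) → m - k + k ≡ m
m-k+k≡m = ℤSolver.solve-∀

m+k≤n⇒m≤n-k : ∀ {m n} k → m + k ℤ.≤ n → m ℤ.≤ n - k
m+k≤n⇒m≤n-k {m} {n} k m+k≤n = subst (ℤ._≤ n - k) (m+k-k≡m m k) (ℤₚ.+-monoˡ-≤ (- k) m+k≤n)

m+k≡n⇔m≡n-k : ∀ {m n} k → (m + k ≡ n) ⇔ (m ≡ n - k)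
m+k≡n⇔m≡n-k {m} {n} k = mk⇔ (λ m+k≡n → trans (sym (m+k-k≡m m k)) (cong (_- k) m+k≡n))
                            (λ m≡n-k → trans (cong (_+ k) m≡n-k) (m-k+k≡m n k))

Exposes-switch : ∀ {d} {V : List (Point01 d)} {P : Point01 d → Set} (t : Point01 d) →
  (∀ w → w ∈ V → t ⊕ w ∈ V) → Exposes V P → Exposes V (λ w → P (t ⊕ w))
Exposes-switch {P = P} t closed (c , b , below , onFace) =
  flipSigns t c , b - dot c t ,
  (λ w w∈ → m+k≤n⇒m≤n-k (dot c t) (subst (ℤ._≤ b) (dot-⊕ t w c) (below (t ⊕ w) (closed w w∈)))) ,
  (λ w w∈ → ⇔.trans (⇔.sym (m+k≡n⇔m≡n-k (dot c t)))
              (subst (λ x → (x ≡ b) ⇔ P (t ⊕ w)) (dot-⊕ t w c) (onFace (t ⊕ w) (closed w w∈))))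

switchTriple : ∀ {d} {V : List (Point01 d)} {x y z x′ y′ z′ : Point01 d} (t : Point01 d) →
  (∀ w → w ∈ V → t ⊕ w ∈ V) → t ⊕ x ≡ x′ → t ⊕ y ≡ y′ → t ⊕ z ≡ z′ →
  Exposes V (Triple x′ y′ z′) → Exposes V (Triple x y z)
switchTriple t closed refl refl refl face =
  Exposes-⇔ (λ w → cancel w ⊎-cong cancel w ⊎-cong cancel w) (Exposes-switch t closed face)
  where
  cancel : ∀ w {x} → (t ⊕ w ≡ t ⊕ x) ⇔ (w ≡ x)
  cancel w = mk⇔ (⊕-injective t) (cong (t ⊕_))

-- Faces through three cut vectors

NegativeUnless : Set → ℤ → Set
NegativeUnless P w = (w ≡ 0ℤ × P) ⊎ w ℤ.< 0ℤ

negativeUnless-nonpos : ∀ {P w} → NegativeUnless P w → w ℤ.≤ 0ℤ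
negativeUnless-nonpos (inj₁ (refl , _)) = ℤₚ.≤-refl
negativeUnless-nonpos (inj₂ w<0)        = ℤₚ.<⇒≤ w<0

negativeUnless-zero : ∀ {P w} → NegativeUnless P w → w ≡ 0ℤ → P
negativeUnless-zero (inj₁ (_ , p)) _    = p
negativeUnless-zero (inj₂ w<0)     refl = ⊥-elim (ℤₚ.<-irrefl refl w<0)

-- Weights between the representatives 0, a, b (, c) of the classes of (A, B), as functions of the sides
-- r, x, y (, z) of a cut: two triangle inequalities and, for four classes, the negative-type inequality
-- Σ b_i b_j x_ij ≤ 0 with b = (1, −1, −1, 1), whose value on a cut S is −(Σ_{i ∈ S} b_i)².
disjointWeight : Bool → Bool → Bool → ℤ
disjointWeight r x y = select (x xor y) 1ℤ + (select (r xor x) -1ℤ + (select (r xor y) -1ℤ + 0ℤ))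

DisjointPattern : Bool → Bool → Set
DisjointPattern x y = (x ≡ false × y ≡ false) ⊎ (x ≡ true × y ≡ false) ⊎ (x ≡ false × y ≡ true)

disjointWeight-cases : ∀ x y → NegativeUnless (DisjointPattern x y) (disjointWeight false x y)
disjointWeight-cases false false = inj₁ (refl , inj₁ (refl , refl))
disjointWeight-cases true  false = inj₁ (refl , inj₂ (inj₁ (refl , refl)))
disjointWeight-cases false true  = inj₁ (refl , inj₂ (inj₂ (refl , refl)))
disjointWeight-cases true  true  = inj₂ ℤ.-<+

nestedWeight : Bool → Bool → Bool → ℤ
nestedWeight r x z = select (r xor x) -1ℤ + (select (r xor z) 1ℤ + (select (x xor z) -1ℤ + 0ℤ))

NestedPattern : Bool → Bool → Set
NestedPattern x z = (x ≡ false × z ≡ false) ⊎ (x ≡ false × z ≡ true) ⊎ (x ≡ true × z ≡ true)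

nestedWeight-cases : ∀ x z → NegativeUnless (NestedPattern x z) (nestedWeight false x z)
nestedWeight-cases false false = inj₁ (refl , inj₁ (refl , refl))
nestedWeight-cases false true  = inj₁ (refl , inj₂ (inj₁ (refl , refl)))
nestedWeight-cases true  true  = inj₁ (refl , inj₂ (inj₂ (refl , refl)))
nestedWeight-cases true  false = inj₂ ℤ.-<+

crossingWeight : Bool → Bool → Bool → Bool → ℤ
crossingWeight r x y z =
  select (x xor z) -1ℤ + (select (y xor z) -1ℤ + (select (x xor y) 1ℤ +
  (select (r xor x) -1ℤ + (select (r xor y) -1ℤ + (select (r xor z) 1ℤ + 0ℤ)))))

CrossingPattern : Bool → Bool → Bool → Set
CrossingPattern x y z =
  (x ≡ false × y ≡ false × z ≡ false) ⊎ (x ≡ false × y ≡ true × z ≡ true) ⊎ (x ≡ true × y ≡ false × z ≡ true)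

crossingWeight-cases : ∀ x y z → NegativeUnless (CrossingPattern x y z) (crossingWeight false x y z)
crossingWeight-cases false false false = inj₁ (refl , inj₁ (refl , refl , refl))
crossingWeight-cases false true  true  = inj₁ (refl , inj₂ (inj₁ (refl , refl , refl)))
crossingWeight-cases true  false true  = inj₁ (refl , inj₂ (inj₂ (refl , refl , refl)))
crossingWeight-cases false false true  = inj₂ ℤ.-<+
crossingWeight-cases false true  false = inj₂ ℤ.-<+
crossingWeight-cases true  false false = inj₂ ℤ.-<+
crossingWeight-cases true  true  false = inj₂ ℤ.-<+
crossingWeight-cases true  true  true  = inj₂ ℤ.-<+

separatedBy : ∀ {n} (f : Fin n → Bool) {v w} → f v ≡ true → f w ≡ false → v ≢ w
separatedBy f fv fw refl with trans (sym fv) fw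
... | ()

module RootedPair {m : ℕ} (A B : Fin (suc m) → Bool) (A0 : A zero ≡ false) (B0 : B zero ≡ false) where

  class : Fin (suc m) → Bool × Bool
  class v = A v , B v

  classOf : ∀ {r x y} → A r ≡ x → B r ≡ y → class r ≡ (x , y)
  classOf = cong₂ _,_

  ClassConstant : (Fin (suc m) → Bool) → Set
  ClassConstant u = ∀ v w → class v ≡ class w → u v ≡ u w

  ∅-classConstant : ClassConstant ∅
  ∅-classConstant _ _ _ = refl

  A-classConstant : ClassConstant A
  A-classConstant _ _ = cong proj₁

  B-classConstant : ClassConstant B
  B-classConstant _ _ = cong proj₂

  agreeOn : ∀ (reps : List (Fin (suc m))) {u t} → (∀ v → ∃ λ r → r ∈ reps × class v ≡ class r) →
            ClassConstant u → ClassConstant t → All (λ r → u r ≡ t r) reps → u ≗ t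
  agreeOn reps cover u-const t-const onReps v with cover v
  ... | r , r∈ , same = trans (u-const v r same) (trans (All.lookup onReps r∈) (sym (t-const v r same)))

  penaltyWeight : Edge (suc m) → ℤ
  penaltyWeight e = select (not (cut A e ∨ cut B e)) -1ℤ

  penalty : (Fin (suc m) → Bool) → Edge (suc m) → ℤ
  penalty u e = select (cut u e) (penaltyWeight e)

  penalty-nonpos : ∀ u e → penalty u e ℤ.≤ 0ℤ
  penalty-nonpos u e with cut u e | cut A e ∨ cut B e
  ... | false | _     = ℤₚ.≤-refl
  ... | true  | true  = ℤₚ.≤-refl
  ... | true  | false = ℤ.-≤+

  penalty-vanishes : ∀ u e → (cut u e ≡ true → cut A e ∨ cut B e ≡ true) → penalty u e ≡ 0ℤ
  penalty-vanishes u e cut-by-A-or-B with cut u e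
  ... | false = refl
  ... | true rewrite cut-by-A-or-B refl = refl

  penalty≡0⇒uncut : ∀ u e → penalty u e ≡ 0ℤ → cut A e ∨ cut B e ≡ false → cut u e ≡ false
  penalty≡0⇒uncut u e penalty≡0 uncut-by-A-and-B with cut u e
  ... | false = refl
  ... | true rewrite uncut-by-A-and-B with penalty≡0
  ...   | ()

  totalPenalty-nonpos : ∀ u → sumEdges (penalty u) ℤ.≤ 0ℤ
  totalPenalty-nonpos u = sumEdges-nonpos (penalty u) (penalty-nonpos u)

  totalPenalty-vanishes : ∀ u → (∀ e → cut u e ≡ true → cut A e ∨ cut B e ≡ true) → sumEdges (penalty u) ≡ 0ℤ
  totalPenalty-vanishes u cut-by-A-or-B = sumEdges-zero (penalty u) λ e → penalty-vanishes u e (cut-by-A-or-B e)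

  totalPenalty≡0⇒classConstant : ∀ u → sumEdges (penalty u) ≡ 0ℤ → ClassConstant u
  totalPenalty≡0⇒classConstant u penalty≡0 v w same with v Fin.≟ w
  ... | yes v≡w = cong u v≡w
  ... | no v≢w with edgeJoining v≢w
  ...   | q , joins = xor≡false⇒≡ (u v) (u w) (trans (sym (ends u)) u-uncut)
    where
    ends : ∀ f → cut f q ≡ f v xor f w
    ends = joins-comm joins _xor_ Boolₚ.xor-comm
    uncut : ∀ f → f v ≡ f w → cut f q ≡ false
    uncut f fv≡fw = trans (ends f) (trans (cong (_xor f w) fv≡fw) (Boolₚ.xor-same (f w)))
    u-uncut : cut u q ≡ false
    u-uncut = penalty≡0⇒uncut u q (sumEdges-nonpos-zero (penalty u) (penalty-nonpos u) penalty≡0 q)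
      (cong₂ _∨_ (uncut A (cong proj₁ same)) (uncut B (cong proj₂ same)))

  Target : Point01 (edgeCount (suc m)) → Set
  Target = Triple (cutVector (∅ {suc m})) (cutVector A) (cutVector B)

  pairsFace : (ps : WeightedPairs (suc m)) → All Distinct ps →
    (∀ u → u zero ≡ false → cutWeight u ps ℤ.≤ 0ℤ) →
    cutWeight ∅ ps ≡ 0ℤ → cutWeight A ps ≡ 0ℤ → cutWeight B ps ≡ 0ℤ →
    (∀ u → u zero ≡ false → ClassConstant u → cutWeight u ps ≡ 0ℤ → u ≗ ∅ ⊎ u ≗ A ⊎ u ≗ B) →
    Exposes (cutVertices m) Target
  pairsFace ps distinct pairs-nonpos ∅-zero A-zero B-zero pairs-zero = c , 0ℤ , below , onFace
    where
    open ≡-Reasoning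
    weight : Edge (suc m) → ℤ
    weight e = penaltyWeight e + pairWeights ps e
    c : Vec ℤ (edgeCount (suc m))
    c = tabulateEdges weight
    value : ∀ u → dot c (cutVector u) ≡ sumEdges (penalty u) + cutWeight u ps
    value u = begin
      dot c (cutVector u)
        ≡⟨ dot-tabulateEdges (suc m) c (cut u) ⟩
      sumEdges (λ e → select (cut u e) (lookup c (edgeIndex e)))
        ≡⟨ sumEdges-cong (λ e → trans (cong (select (cut u e)) (lookup-tabulateEdges weight e))
                                       (select-distrib-+ (cut u e) (penaltyWeight e) (pairWeights ps e))) ⟩
      sumEdges (λ e → penalty u e + select (cut u e) (pairWeights ps e))
        ≡⟨ sumEdges-distrib-+ (penalty u) (λ e → select (cut u e) (pairWeights ps e)) ⟩
      sumEdges (penalty u) + sumEdges (λ e → select (cut u e) (pairWeights ps e))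
        ≡⟨ cong (sumEdges (penalty u) +_) (sumEdges-pairWeights u ps distinct) ⟩
      sumEdges (penalty u) + cutWeight u ps ∎
    below : ∀ w → w ∈ cutVertices m → dot c w ℤ.≤ 0ℤ
    below w w∈ with ∈-cutVertices⁻ w∈
    ... | S , refl = subst (ℤ._≤ 0ℤ) (sym (value (shore S)))
                           (ℤₚ.+-mono-≤ (totalPenalty-nonpos (shore S)) (pairs-nonpos (shore S) refl))
    onFace : ∀ w → w ∈ cutVertices m → (dot c w ≡ 0ℤ) ⇔ Target w
    onFace w w∈ with ∈-cutVertices⁻ w∈
    ... | S , refl = mk⇔ toTarget fromTarget
      where
      toTarget : dot c (cutVector (shore S)) ≡ 0ℤ → Target (cutVector (shore S))
      toTarget value≡0 with nonpos+nonpos≡0⇒≡0 (totalPenalty-nonpos (shore S)) (pairs-nonpos (shore S) refl)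
                                               (trans (sym (value (shore S))) value≡0)
      ... | penalty≡0 , pairs≡0 =
        Sum.map (cutVector-cong {t = ∅}) (Sum.map (cutVector-cong {t = A}) (cutVector-cong {t = B}))
        (pairs-zero (shore S) refl (totalPenalty≡0⇒classConstant (shore S) penalty≡0) pairs≡0)
      vanishes : ∀ t → (∀ e → cut t e ≡ true → cut A e ∨ cut B e ≡ true) → cutWeight t ps ≡ 0ℤ →
                 dot c (cutVector t) ≡ 0ℤ
      vanishes t cut-by-A-or-B t-zero = trans (value t) (cong₂ _+_ (totalPenalty-vanishes t cut-by-A-or-B) t-zero)
      fromTarget : Target (cutVector (shore S)) → dot c (cutVector (shore S)) ≡ 0ℤ
      fromTarget (inj₁ w≡∅) = trans (cong (dot c) w≡∅) (vanishes ∅ (λ _ ()) ∅-zero)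
      fromTarget (inj₂ (inj₁ w≡A)) = trans (cong (dot c) w≡A) (vanishes A (λ e → cong (_∨ cut B e)) A-zero)
      fromTarget (inj₂ (inj₂ w≡B)) = trans (cong (dot c) w≡B)
        (vanishes B (λ e cutB → trans (cong (cut A e ∨_) cutB) (Boolₚ.∨-zeroʳ (cut A e))) B-zero)

  disjointFace : ∀ {a b} → A a ≡ true → B a ≡ false → A b ≡ false → B b ≡ true →
                 (∀ v → A v ≡ true → B v ≡ true → ⊥) → Exposes (cutVertices m) Target
  disjointFace {a} {b} Aa Ba Ab Bb disjoint =
    pairsFace ps distinct (λ u u0 → negativeUnless-nonpos (rooted u u0)) refl A-zero B-zero pairs-zero
    where
    ps : WeightedPairs (suc m)
    ps = (a , b , 1ℤ) ∷ (zero , a , -1ℤ) ∷ (zero , b , -1ℤ) ∷ []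
    distinct : All Distinct ps
    distinct = separatedBy A Aa Ab ∷ ≢-sym (separatedBy A Aa A0) ∷ ≢-sym (separatedBy B Bb B0) ∷ []
    rooted : ∀ u → u zero ≡ false → NegativeUnless (DisjointPattern (u a) (u b)) (cutWeight u ps)
    rooted u u0 = subst (NegativeUnless _) (cong (λ r → disjointWeight r (u a) (u b)) (sym u0))
                        (disjointWeight-cases (u a) (u b))
    A-zero : disjointWeight (A zero) (A a) (A b) ≡ 0ℤ
    A-zero rewrite A0 | Aa | Ab = refl
    B-zero : disjointWeight (B zero) (B a) (B b) ≡ 0ℤ
    B-zero rewrite B0 | Ba | Bb = refl
    cover : ∀ v → ∃ λ r → r ∈ zero ∷ a ∷ b ∷ [] × class v ≡ class r
    cover v with A v in Av | B v in Bv
    ... | false | false = zero , here refl , sym (classOf A0 B0)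
    ... | true  | false = a , there (here refl) , sym (classOf Aa Ba)
    ... | false | true  = b , there (there (here refl)) , sym (classOf Ab Bb)
    ... | true  | true  = ⊥-elim (disjoint v Av Bv)
    pairs-zero : ∀ u → u zero ≡ false → ClassConstant u → cutWeight u ps ≡ 0ℤ → u ≗ ∅ ⊎ u ≗ A ⊎ u ≗ B
    pairs-zero u u0 u-const u-zero with negativeUnless-zero (rooted u u0) u-zero
    ... | inj₁ (ua , ub) = inj₁ (agreeOn _ cover u-const ∅-classConstant (u0 ∷ ua ∷ ub ∷ []))
    ... | inj₂ (inj₁ (ua , ub)) = inj₂ (inj₁ (agreeOn _ cover u-const A-classConstant
          (trans u0 (sym A0) ∷ trans ua (sym Aa) ∷ trans ub (sym Ab) ∷ [])))
    ... | inj₂ (inj₂ (ua , ub)) = inj₂ (inj₂ (agreeOn _ cover u-const B-classConstant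
          (trans u0 (sym B0) ∷ trans ua (sym Ba) ∷ trans ub (sym Bb) ∷ [])))

  nestedFace : ∀ {a c} → A a ≡ false → B a ≡ true → A c ≡ true → B c ≡ true →
               (∀ v → A v ≡ true → B v ≡ false → ⊥) → Exposes (cutVertices m) Target
  nestedFace {a} {c} Aa Ba Ac Bc A⊆B =
    pairsFace ps distinct (λ u u0 → negativeUnless-nonpos (rooted u u0)) refl A-zero B-zero pairs-zero
    where
    ps : WeightedPairs (suc m)
    ps = (zero , a , -1ℤ) ∷ (zero , c , 1ℤ) ∷ (a , c , -1ℤ) ∷ []
    distinct : All Distinct ps
    distinct = ≢-sym (separatedBy B Ba B0) ∷ ≢-sym (separatedBy A Ac A0) ∷ ≢-sym (separatedBy A Ac Aa) ∷ []
    rooted : ∀ u → u zero ≡ false → NegativeUnless (NestedPattern (u a) (u c)) (cutWeight u ps)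
    rooted u u0 = subst (NegativeUnless _) (cong (λ r → nestedWeight r (u a) (u c)) (sym u0))
                        (nestedWeight-cases (u a) (u c))
    A-zero : nestedWeight (A zero) (A a) (A c) ≡ 0ℤ
    A-zero rewrite A0 | Aa | Ac = refl
    B-zero : nestedWeight (B zero) (B a) (B c) ≡ 0ℤ
    B-zero rewrite B0 | Ba | Bc = refl
    cover : ∀ v → ∃ λ r → r ∈ zero ∷ a ∷ c ∷ [] × class v ≡ class r
    cover v with A v in Av | B v in Bv
    ... | false | false = zero , here refl , sym (classOf A0 B0)
    ... | false | true  = a , there (here refl) , sym (classOf Aa Ba)
    ... | true  | true  = c , there (there (here refl)) , sym (classOf Ac Bc)
    ... | true  | false = ⊥-elim (A⊆B v Av Bv)
    pairs-zero : ∀ u → u zero ≡ false → ClassConstant u → cutWeight u ps ≡ 0ℤ → u ≗ ∅ ⊎ u ≗ A ⊎ u ≗ B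
    pairs-zero u u0 u-const u-zero with negativeUnless-zero (rooted u u0) u-zero
    ... | inj₁ (ua , uc) = inj₁ (agreeOn _ cover u-const ∅-classConstant (u0 ∷ ua ∷ uc ∷ []))
    ... | inj₂ (inj₁ (ua , uc)) = inj₂ (inj₁ (agreeOn _ cover u-const A-classConstant
          (trans u0 (sym A0) ∷ trans ua (sym Aa) ∷ trans uc (sym Ac) ∷ [])))
    ... | inj₂ (inj₂ (ua , uc)) = inj₂ (inj₂ (agreeOn _ cover u-const B-classConstant
          (trans u0 (sym B0) ∷ trans ua (sym Ba) ∷ trans uc (sym Bc) ∷ [])))

  crossingFace : ∀ {a b c} → A a ≡ false → B a ≡ true → A b ≡ true → B b ≡ false → A c ≡ true → B c ≡ true →
                 Exposes (cutVertices m) Target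
  crossingFace {a} {b} {c} Aa Ba Ab Bb Ac Bc =
    pairsFace ps distinct (λ u u0 → negativeUnless-nonpos (rooted u u0)) refl A-zero B-zero pairs-zero
    where
    ps : WeightedPairs (suc m)
    ps = (a , c , -1ℤ) ∷ (b , c , -1ℤ) ∷ (a , b , 1ℤ)
       ∷ (zero , a , -1ℤ) ∷ (zero , b , -1ℤ) ∷ (zero , c , 1ℤ) ∷ []
    distinct : All Distinct ps
    distinct = ≢-sym (separatedBy A Ac Aa) ∷ ≢-sym (separatedBy B Bc Bb) ∷ ≢-sym (separatedBy A Ab Aa)
             ∷ ≢-sym (separatedBy B Ba B0) ∷ ≢-sym (separatedBy A Ab A0) ∷ ≢-sym (separatedBy A Ac A0) ∷ []
    rooted : ∀ u → u zero ≡ false → NegativeUnless (CrossingPattern (u a) (u b) (u c)) (cutWeight u ps)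
    rooted u u0 = subst (NegativeUnless _) (cong (λ r → crossingWeight r (u a) (u b) (u c)) (sym u0))
                        (crossingWeight-cases (u a) (u b) (u c))
    A-zero : crossingWeight (A zero) (A a) (A b) (A c) ≡ 0ℤ
    A-zero rewrite A0 | Aa | Ab | Ac = refl
    B-zero : crossingWeight (B zero) (B a) (B b) (B c) ≡ 0ℤ
    B-zero rewrite B0 | Ba | Bb | Bc = refl
    cover : ∀ v → ∃ λ r → r ∈ zero ∷ a ∷ b ∷ c ∷ [] × class v ≡ class r
    cover v with A v in Av | B v in Bv
    ... | false | false = zero , here refl , sym (classOf A0 B0)
    ... | false | true  = a , there (here refl) , sym (classOf Aa Ba)
    ... | true  | false = b , there (there (here refl)) , sym (classOf Ab Bb)
    ... | true  | true  = c , there (there (there (here refl))) , sym (classOf Ac Bc)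
    pairs-zero : ∀ u → u zero ≡ false → ClassConstant u → cutWeight u ps ≡ 0ℤ → u ≗ ∅ ⊎ u ≗ A ⊎ u ≗ B
    pairs-zero u u0 u-const u-zero with negativeUnless-zero (rooted u u0) u-zero
    ... | inj₁ (ua , ub , uc) = inj₁ (agreeOn _ cover u-const ∅-classConstant (u0 ∷ ua ∷ ub ∷ uc ∷ []))
    ... | inj₂ (inj₁ (ua , ub , uc)) = inj₂ (inj₁ (agreeOn _ cover u-const A-classConstant
          (trans u0 (sym A0) ∷ trans ua (sym Aa) ∷ trans ub (sym Ab) ∷ trans uc (sym Ac) ∷ [])))
    ... | inj₂ (inj₂ (ua , ub , uc)) = inj₂ (inj₂ (agreeOn _ cover u-const B-classConstant
          (trans u0 (sym B0) ∷ trans ua (sym Ba) ∷ trans ub (sym Bb) ∷ trans uc (sym Bc) ∷ [])))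

rootedFace : ∀ {m} (A B : Fin (suc m) → Bool) → A zero ≡ false → B zero ≡ false →
  ¬ A ≗ ∅ → ¬ B ≗ ∅ → ¬ A ≗ B →
  Exposes (cutVertices m) (Triple (cutVector (∅ {suc m})) (cutVector A) (cutVector B))
rootedFace A B A0 B0 A≉∅ B≉∅ A≉B with inhabited false true | inhabited true false | inhabited true true
  where
  inhabited : ∀ x y → Dec (∃ λ v → A v ≡ x × B v ≡ y)
  inhabited x y = Finₚ.any? (λ v → (A v Boolₚ.≟ x) ×-dec (B v Boolₚ.≟ y))
... | yes (a , Aa , Ba) | yes (b , Ab , Bb) | no none₁₁ =
  disjointFace Ab Bb Aa Ba (λ v Av Bv → none₁₁ (v , Av , Bv))
  where open RootedPair A B A0 B0
... | yes (a , Aa , Ba) | no none₁₀ | yes (c , Ac , Bc) =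
  nestedFace Aa Ba Ac Bc (λ v Av Bv → none₁₀ (v , Av , Bv))
  where open RootedPair A B A0 B0
... | no none₀₁ | yes (b , Ab , Bb) | yes (c , Ac , Bc) =
  Exposes-⇔ (λ _ → mk⇔ (Sum.map₂ Sum.swap) (Sum.map₂ Sum.swap))
            (RootedPair.nestedFace B A B0 A0 Bb Ab Bc Ac (λ v Bv Av → none₀₁ (v , Av , Bv)))
... | yes (a , Aa , Ba) | yes (b , Ab , Bb) | yes (c , Ac , Bc) = crossingFace Aa Ba Ab Bb Ac Bc
  where open RootedPair A B A0 B0
... | no none₀₁ | no none₁₀ | _ = ⊥-elim (A≉B A≗B)
  where
  A≗B : A ≗ B
  A≗B v with A v in Av | B v in Bv
  ... | false | false = refl
  ... | true  | true  = refl
  ... | false | true  = ⊥-elim (none₀₁ (v , Av , Bv))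
  ... | true  | false = ⊥-elim (none₁₀ (v , Av , Bv))
... | no none₀₁ | yes _ | no none₁₁ = ⊥-elim (B≉∅ B≗∅)
  where
  B≗∅ : B ≗ ∅
  B≗∅ v with A v in Av | B v in Bv
  ... | _     | false = refl
  ... | false | true  = ⊥-elim (none₀₁ (v , Av , Bv))
  ... | true  | true  = ⊥-elim (none₁₁ (v , Av , Bv))
... | yes _ | no none₁₀ | no none₁₁ = ⊥-elim (A≉∅ A≗∅)
  where
  A≗∅ : A ≗ ∅
  A≗∅ v with A v in Av | B v in Bv
  ... | false | _     = refl
  ... | true  | false = ⊥-elim (none₁₀ (v , Av , Bv))
  ... | true  | true  = ⊥-elim (none₁₁ (v , Av , Bv))

cutVertices-threeNeighborly : ∀ m → ThreeNeighborly (cutVertices m)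
cutVertices-threeNeighborly m x y z x∈ y∈ z∈ x≢y y≢z x≢z
  with ∈-cutVertices⁻ x∈ | ∈-cutVertices⁻ y∈ | ∈-cutVertices⁻ z∈
... | S , refl | T , refl | U , refl =
  switchTriple (cutVector s) (⊕-cutVertices s)
    (trans (cutVector-⊕ s s) (cutVector-cong (Boolₚ.xor-same ∘ s))) (cutVector-⊕ s t) (cutVector-⊕ s u)
    (rootedFace A B refl refl (x≢y ∘ same-cut t) (x≢z ∘ same-cut u) (y≢z ∘ cutVector-cong ∘ cancel))
  where
  s t u : Fin (suc m) → Bool
  s = shore S
  t = shore T
  u = shore U
  A B : Fin (suc m) → Bool
  A v = s v xor t v
  B v = s v xor u v
  same-cut : ∀ t → (λ v → s v xor t v) ≗ ∅ → cutVector s ≡ cutVector t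
  same-cut t s⊕t≗∅ = cutVector-cong (λ v → xor≡false⇒≡ (s v) (t v) (s⊕t≗∅ v))
  cancel : A ≗ B → t ≗ u
  cancel A≗B v =
    trans (sym (xor-cancelˡ (s v) (t v))) (trans (cong (s v xor_) (A≗B v)) (xor-cancelˡ (s v) (u v)))

mainTheorem7 : (n : ℕ) → 2 ≤ n →
    Σ (List (Point01 (n C 2))) λ V →
    Unique V × FullDim V × ThreeNeighborly V × MoreThanBound (n C 2) (length V)
mainTheorem7 zero    ()
mainTheorem7 (suc m) _ =
  subst (λ d → Σ (List (Point01 d)) λ V → Unique V × FullDim V × ThreeNeighborly V × MoreThanBound d (length V))
        (edgeCount≡C2 (suc m))
        ( cutVertices m
        , cutVertices-unique m
        , cutVertices-fullDim m
        , cutVertices-threeNeighborly m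
        , subst (MoreThanBound (edgeCount (suc m))) (sym (length-cutVertices m)) (moreThanBound-2^m m))
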